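{- Let $k\geq 2$ be an integer. If a connected graph $G$ contains a $(k+2c-2)$-strong $H$-model for some graph $H$ with $c$ connected components, then $G$ contains a $k$-strong $H'$-model for some connected graph $H'$ with $|E(H')|=|E(H)|$.
   Context: For a graph $H$ with vertex set $\{v_1,\dots,v_h\}$ and an integer $m$, an $m$-strong $H$-model in a graph $G$ consists of $h$ pairwise disjoint connected subgraphs $X_1,\dots,X_h$ of $G$ such that for each edge $v_iv_j$ of $H$ there are at least $m$ vertices in $V(G)\setminus\bigcup_{i=1}^h V(X_i)$ each adjacent to some vertex of $X_i$ and to some vertex of $X_j$ (the same vertex may count for several edges). -}

module Defs where

open import Data.Nat using (ℕ; zero; suc; _+_; _<ᵇ_)
open import Data.Bool using (Bool; true; false; _∧_; if_then_else_)
open import Data.Fin using (Fin; toℕ)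
open import Data.List using (List; map; allFin)
open import Data.Nat.ListAction using (sum)
open import Data.Product using (Σ; _×_; ∃; ∃-syntax)
open import Relation.Binary.PropositionalEquality using (_≡_; _≢_)
open import Function.Definitions using (Injective)

record Graph : Set where
  field
    n      : ℕ
    adj    : Fin n → Fin n → Bool
    sym    : ∀ u v → adj u v ≡ adj v u
    irrefl : ∀ v → adj v v ≡ false

open Graph public

VSet : Graph → Set
VSet G = Fin (n G) → Bool

data ReachIn (G : Graph) (S : VSet G) : Fin (n G) → Fin (n G) → Set where
  here : ∀ {u} → S u ≡ true → ReachIn G S u u
  step : ∀ {u w v} → S u ≡ true → adj G u w ≡ true → ReachIn G S w v → ReachIn G S u v

ConnectedSet : (G : Graph) → VSet G → Set
ConnectedSet G S =
  (∃[ v ] S v ≡ true) ×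
  (∀ u v → S u ≡ true → S v ≡ true → ReachIn G S u v)

full : (G : Graph) → VSet G
full G _ = true

Connected : Graph → Set
Connected G = ConnectedSet G (full G)

HasComponents : Graph → ℕ → Set
HasComponents H c =
  Σ (Fin (n H) → Fin c) λ comp →
    (∀ (i : Fin c) → ∃[ v ] comp v ≡ i) ×
    (∀ u v → (comp u ≡ comp v → ReachIn H (full H) u v)
           × (ReachIn H (full H) u v → comp u ≡ comp v))

numEdges : Graph → ℕ
numEdges G =
  sum (map (λ i → sum (map (λ j →
    if (adj G i j ∧ (toℕ i <ᵇ toℕ j)) then 1 else 0) (allFin (n G)))) (allFin (n G)))

StrongModel : ℕ → (H G : Graph) → Set
StrongModel m H G =
  Σ (Fin (n H) → VSet G) λ X →
    (∀ i → ConnectedSet G (X i)) ×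
    (∀ i j x → i ≢ j → X i x ≡ true → X j x ≡ false) ×
    (∀ i j → adj H i j ≡ true →
      Σ (Fin m → Fin (n G)) λ f →
        Injective _≡_ _≡_ f ×
        (∀ t → (∀ l → X l (f t) ≡ false)
             × (∃[ x ] (X i x ≡ true × adj G (f t) x ≡ true))
             × (∃[ y ] (X j y ≡ true × adj G (f t) y ≡ true))))

module Submission where

-- Lemma 16.  Induction on the number c of components of H, carried as a
-- labelling of V(H) by Fin c.  If H is connected (or empty: use K₁) the
-- model is already k-strong, as k + 2c - 2 ≥ k.  Otherwise a walk in G
-- between branch sets of different components is shortcut until it is a
-- connector from some X a to some X b: its interior P avoids all branch sets
-- and only two vertices p, q of P touch any of them.  Identifying a and b in
-- H keeps the number of edges (a, b are non-adjacent without a common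
-- neighbour) and merges two components; X a ∪ X b ∪ P becomes the new
-- branch set, and dropping p, q from each witness family costs strength 2.

open import Defs
open import Data.Nat using (ℕ; _+_; _*_; _∸_; _≤_)
open import Data.Product using (Σ; _×_)
open import Relation.Binary.PropositionalEquality using (_≡_)

open import Data.Nat using (zero; suc; _<_; _<ᵇ_; z≤n; s≤s; s≤s⁻¹; _<?_; _≤?_) renaming (_≟_ to _≟ℕ_)
open import Data.Nat.Properties
open import Data.Nat.Tactic.RingSolver using (solve-∀)
open import Data.Nat.Induction using (<-rec)
open import Data.Bool using (Bool; true; false; _∧_; _∨_; if_then_else_) renaming (_≟_ to _≟𝔹_)
open import Data.Bool.Properties using (∨-comm; ¬-not)
open import Data.Fin using (Fin; zero; suc; toℕ; punchIn; punchOut; inject≤)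
open import Data.Fin.Properties using (¬Fin0; toℕ-injective; punchIn-injective; punchInᵢ≢i; any?; all?; ¬∀⟶∃¬; inject≤-injective; punchIn-punchOut; punchOut-punchIn; punchOut-injective; punchOut-cong) renaming (_≟_ to _≟F_; suc-injective to Fin-suc-injective)
open import Data.Product using (_,_; proj₁; proj₂; ∃; ∃-syntax)
open import Data.Sum using (_⊎_; inj₁; inj₂; [_,_]′)
open import Data.Empty using (⊥; ⊥-elim)
open import Relation.Nullary using (¬_; Dec; yes; no; does)
open import Relation.Nullary.Decidable using (_×-dec_; dec-true; dec-false)
open import Relation.Binary.PropositionalEquality using (_≢_; ≢-sym; refl; trans; cong; cong₂; subst; subst₂; module ≡-Reasoning) renaming (sym to ≡-sym)
open import Relation.Binary.Definitions using (tri<; tri≈; tri>)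
open import Function.Definitions using (Injective)
open import Data.List using (map; allFin; tabulate)
open import Data.List.Properties using (map-tabulate)
import Data.Nat.ListAction as List
open import Algebra.Properties.CommutativeMonoid.Sum +-0-commutativeMonoid using (sum; sum-syntax; sum-remove; ∑-distrib-+; ∑-comm; sum-cong-≗; sum-replicate-zero)

∨-split : ∀ {x y : Bool} → x ∨ y ≡ true → x ≡ true ⊎ y ≡ true
∨-split {true}  _ = inj₁ refl
∨-split {false} e = inj₂ e

∨-introˡ : ∀ {x : Bool} (y : Bool) → x ≡ true → x ∨ y ≡ true
∨-introˡ y refl = refl

∨-introʳ : ∀ (x : Bool) {y : Bool} → y ≡ true → x ∨ y ≡ true
∨-introʳ true  _ = refl
∨-introʳ false e = e

∧-proj₁ : ∀ {x y : Bool} → x ∧ y ≡ true → x ≡ true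
∧-proj₁ {true} _ = refl

∧-proj₂ : ∀ {x y : Bool} → x ∧ y ≡ true → y ≡ true
∧-proj₂ {true} e = e

∧-intro : ∀ {x y : Bool} → x ≡ true → y ≡ true → x ∧ y ≡ true
∧-intro refl refl = refl

true≢false : ∀ {x : Bool} → x ≡ true → x ≡ false → ⊥
true≢false refl ()

dec-sound : ∀ {ℓ} {P : Set ℓ} (d : Dec P) → does d ≡ true → P
dec-sound (yes p) _ = p

module _ {G : Graph} {S : VSet G} where

  reach-start : ∀ {u v} → ReachIn G S u v → S u ≡ true
  reach-start (here s)     = s
  reach-start (step s _ _) = s

  reach-trans : ∀ {u v w} → ReachIn G S u v → ReachIn G S v w → ReachIn G S u w
  reach-trans (here _)     r' = r'
  reach-trans (step s e r) r' = step s e (reach-trans r r')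

  reach-sym : ∀ {u v} → ReachIn G S u v → ReachIn G S v u
  reach-sym (here s) = here s
  reach-sym {u} (step {w = w} s e r) =
    reach-trans (reach-sym r) (step (reach-start r) (trans (Graph.sym G w u) e) (here s))

reach-mono : ∀ {G : Graph} {S T : VSet G} → (∀ x → S x ≡ true → T x ≡ true) →
  ∀ {u v} → ReachIn G S u v → ReachIn G T u v
reach-mono S⊆T (here s)     = here (S⊆T _ s)
reach-mono S⊆T (step s e r) = step (S⊆T _ s) e (reach-mono S⊆T r)

-- Explicit walks, indexed by ℕ, which allow surgery at a given position.

record Walk (G : Graph) : Set where
  field
    len  : ℕ
    at   : ℕ → Fin (n G)
    edge : ∀ i → i < len → adj G (at i) (at (suc i)) ≡ true

module _ {G : Graph} where
  open Walk

  consW : (z : Fin (n G)) (W : Walk G) → adj G z (at W 0) ≡ true → Walk G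
  consW z W e = record { len = suc (len W) ; at = at′ ; edge = edge′ }
    where
    at′ : ℕ → Fin (n G)
    at′ zero    = z
    at′ (suc i) = at W i
    edge′ : ∀ i → i < suc (len W) → adj G (at′ i) (at′ (suc i)) ≡ true
    edge′ zero    _  = e
    edge′ (suc i) lt = edge W i (s≤s⁻¹ lt)

  toWalk : ∀ {S u v} → ReachIn G S u v → Σ (Walk G) λ W → at W 0 ≡ u × at W (len W) ≡ v
  toWalk {u = u} (here _) = record { len = 0 ; at = λ _ → u ; edge = λ _ () } , refl , refl
  toWalk {u = u} (step _ e r) with toWalk r
  ... | W , start , end = consW u W (subst (λ t → adj G u t ≡ true) (≡-sym start) e) , refl , end

  dropW : (W : Walk G) (J : ℕ) → J ≤ len W → Walk G
  dropW W J J≤len = record { len = len W ∸ J ; at = λ i → at W (i + J)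
    ; edge = λ i lt → edge W (i + J) (m≤o∸n⇒m+n≤o (suc i) J≤len lt) }

  takeW : (W : Walk G) (J : ℕ) → J ≤ len W → Walk G
  takeW W J J≤len = record { len = J ; at = at W ; edge = λ i lt → edge W i (<-≤-trans lt J≤len) }

  snocAt : Walk G → Fin (n G) → ℕ → Fin (n G)
  snocAt W z i = if does (i ≤? len W) then at W i else z

  snocAt-init : ∀ W z i → i ≤ len W → snocAt W z i ≡ at W i
  snocAt-init W z i i≤len rewrite dec-true (i ≤? len W) i≤len = refl

  snocAt-last : ∀ W z → snocAt W z (suc (len W)) ≡ z
  snocAt-last W z rewrite dec-false (suc (len W) ≤? len W) (<-irrefl refl) = refl

  snocW : (W : Walk G) (z : Fin (n G)) → adj G (at W (len W)) z ≡ true → Walk G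
  snocW W z e = record { len = suc (len W) ; at = snocAt W z ; edge = edge′ }
    where
    edge′ : ∀ i → i < suc (len W) → adj G (snocAt W z i) (snocAt W z (suc i)) ≡ true
    edge′ i lt with i ≟ℕ len W
    ... | yes refl = subst₂ (λ x y → adj G x y ≡ true)
            (≡-sym (snocAt-init W z i ≤-refl)) (≡-sym (snocAt-last W z)) e
    ... | no  i≢len = subst₂ (λ x y → adj G x y ≡ true)
            (≡-sym (snocAt-init W z i (<⇒≤ i<len))) (≡-sym (snocAt-init W z (suc i) i<len)) (edge W i i<len)
      where
      i<len : i < len W
      i<len = ≤∧≢⇒< (s≤s⁻¹ lt) i≢len

ind : Bool → ℕ
ind b = if b then 1 else 0

ind-∨₃ : ∀ x y z → (x ≡ true → y ≡ true → ⊥) → (x ≡ true → z ≡ true → ⊥) → (y ≡ true → z ≡ true → ⊥) →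
  ind (x ∨ (y ∨ z)) ≡ ind x + (ind y + ind z)
ind-∨₃ true  true  _     xy _  _  = ⊥-elim (xy refl refl)
ind-∨₃ true  false true  _  xz _  = ⊥-elim (xz refl refl)
ind-∨₃ true  false false _  _  _  = refl
ind-∨₃ false true  true  _  _  yz = ⊥-elim (yz refl refl)
ind-∨₃ false true  false _  _  _  = refl
ind-∨₃ false false true  _  _  _  = refl
ind-∨₃ false false false _  _  _  = refl

ind-∧ : ∀ x y → ind (x ∧ y) ≡ (if x then ind y else 0)
ind-∧ true  _ = refl
ind-∧ false _ = refl

sum-allFin : ∀ m (f : Fin m → ℕ) → List.sum (map f (allFin m)) ≡ ∑[ i < m ] f i
sum-allFin m f = trans (cong List.sum (map-tabulate (λ i → i) f)) (sum-tabulate m f)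
  where
  sum-tabulate : ∀ m (f : Fin m → ℕ) → List.sum (tabulate f) ≡ sum f
  sum-tabulate zero    f = refl
  sum-tabulate (suc m) f = cong (f zero +_) (sum-tabulate m (λ i → f (suc i)))

sum-point : ∀ {m} (i : Fin m) (g : ℕ) → ∑[ y < m ] (if does (y ≟F i) then g else 0) ≡ g
sum-point {suc m} i g = begin
  sum t                                ≡⟨ sum-remove {i = i} t ⟩
  t i + ∑[ y < m ] t (punchIn i y)     ≡⟨ cong₂ _+_ t-at-i (sum-cong-≗ t-off-i) ⟩
  g + ∑[ y < m ] 0                     ≡⟨ cong (g +_) (sum-replicate-zero m) ⟩
  g + 0                                ≡⟨ +-identityʳ g ⟩
  g                                    ∎
  where
  open ≡-Reasoning
  t : Fin (suc m) → ℕ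
  t y = if does (y ≟F i) then g else 0
  t-at-i : t i ≡ g
  t-at-i rewrite dec-true (i ≟F i) refl = refl
  t-off-i : ∀ y → t (punchIn i y) ≡ 0
  t-off-i y rewrite dec-false (punchIn i y ≟F i) (punchInᵢ≢i i y) = refl

degreeSum : Graph → ℕ
degreeSum G = ∑[ i < n G ] ∑[ j < n G ] ind (adj G i j)

handshake : ∀ G → degreeSum G ≡ 2 * numEdges G
handshake G = begin
  degreeSum G                                        ≡⟨ sum-cong-≗ (λ i → sum-cong-≗ (λ j → both-orders i j)) ⟩
  ∑[ i < N ] ∑[ j < N ] (E i j + E j i)              ≡⟨ sum-cong-≗ (λ i → ∑-distrib-+ (E i) (λ j → E j i)) ⟩
  ∑[ i < N ] (∑[ j < N ] E i j + ∑[ j < N ] E j i)   ≡⟨ ∑-distrib-+ (λ i → ∑[ j < N ] E i j) (λ i → ∑[ j < N ] E j i) ⟩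
  edges + ∑[ i < N ] ∑[ j < N ] E j i                ≡⟨ cong (edges +_) (∑-comm (λ i j → E j i)) ⟩
  edges + edges                                      ≡⟨ cong (λ x → x + x) (≡-sym numEdges-as-sum) ⟩
  numEdges G + numEdges G                            ≡⟨ cong (numEdges G +_) (≡-sym (+-identityʳ _)) ⟩
  2 * numEdges G                                     ∎
  where
  open ≡-Reasoning
  N : ℕ
  N = n G
  E : Fin N → Fin N → ℕ
  E i j = ind (adj G i j ∧ (toℕ i <ᵇ toℕ j))
  edges : ℕ
  edges = ∑[ i < N ] ∑[ j < N ] E i j
  numEdges-as-sum : numEdges G ≡ edges
  numEdges-as-sum = trans (sum-allFin N _) (sum-cong-≗ (λ i → sum-allFin N (E i)))
  both-orders : ∀ i j → ind (adj G i j) ≡ E i j + E j i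
  both-orders i j rewrite Graph.sym G j i with adj G i j in ij
  ... | false = refl
  ... | true with <-cmp (toℕ i) (toℕ j)
  ...   | tri< i<j _ i≯j rewrite dec-true (toℕ i <? toℕ j) i<j | dec-false (toℕ j <? toℕ i) i≯j = refl
  ...   | tri> i≮j _ i>j rewrite dec-true (toℕ j <? toℕ i) i>j | dec-false (toℕ i <? toℕ j) i≮j = refl
  ...   | tri≈ _ i≡j _ rewrite toℕ-injective i≡j = ⊥-elim (true≢false ij (Graph.irrefl G j))

-- Removing one value from an injective family of length N + 1 leaves an
-- injective family of length N avoiding that value; this is how a witness
-- family loses a vertex that joins a branch set.
avoid-value : ∀ {V : Set} {N} → (∀ (x y : V) → Dec (x ≡ y)) →
  (f : Fin (suc N) → V) → Injective _≡_ _≡_ f → (p : V) →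
  Σ (Fin N → Fin (suc N)) λ h → Injective _≡_ _≡_ (λ t → f (h t)) × (∀ t → f (h t) ≢ p)
avoid-value _≟V_ f f-inj p with any? (λ t → f t ≟V p)
... | yes (t₀ , ft₀≡p) = punchIn t₀ , (λ {x} {y} e → punchIn-injective t₀ x y (f-inj e))
                       , (λ t e → punchInᵢ≢i t₀ t (f-inj (trans e (≡-sym ft₀≡p))))
... | no  p∉f          = suc , (λ e → Fin-suc-injective (f-inj e)) , (λ t e → p∉f (suc t , e))

weaken : ∀ {k M H G} → k ≤ M → StrongModel M H G → StrongModel k H G
weaken k≤M (X , connected , disjoint , witnesses) = X , connected , disjoint , λ i j e →
  let (f , f-inj , f-ok) = witnesses i j e in
  (λ t → f (inject≤ t k≤M)) , (λ {x} {y} eq → inject≤-injective k≤M k≤M x y (f-inj eq)) ,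
  (λ t → f-ok (inject≤ t k≤M))

K₁ : Graph
K₁ = record { n = 1 ; adj = λ _ _ → false ; sym = λ _ _ → refl ; irrefl = λ _ → refl }

K₁-connected : Connected K₁
K₁-connected = (zero , refl) , λ { zero zero _ _ → here refl }

K₁-model : ∀ k (G : Graph) → Fin (n G) → StrongModel k K₁ G
K₁-model k G x₀ = X , (λ _ → (x₀ , dec-true (x₀ ≟F x₀) refl) , X-connected)
                    , (λ { zero zero _ 0≢0 → ⊥-elim (0≢0 refl) }) , λ { _ _ () }
  where
  X : Fin 1 → VSet G
  X _ x = does (x ≟F x₀)
  X-connected : ∀ u v → X zero u ≡ true → X zero v ≡ true → ReachIn G (X zero) u v
  X-connected u v u∈X v∈X = subst (ReachIn G (X zero) u)
    (trans (dec-sound (u ≟F x₀) u∈X) (≡-sym (dec-sound (v ≟F x₀) v∈X))) (here u∈X)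

Conclusion : ℕ → Graph → Graph → Set
Conclusion k G H = Σ Graph (λ H′ → Connected H′ × numEdges H′ ≡ numEdges H × StrongModel k H′ G)

-- If any two vertices of H are joined by a walk, the model of H itself
-- proves the conclusion (K₁ replaces H when H is empty).
connected-case : ∀ {k M} (G H : Graph) → Connected G → (∀ u v → ReachIn H (full H) u v) →
  (Fin (n H) → k ≤ M) → StrongModel M H G → Conclusion k G H
connected-case {k} G record { n = zero } G-conn _ _ _ = K₁ , K₁-connected , refl , K₁-model k G (proj₁ (proj₁ G-conn))
connected-case G H@record { n = suc _ } _ reach k≤M model =
  H , ((zero , refl) , λ u v _ _ → reach u v) , refl , weaken {H = H} {G = G} (k≤M zero) model

-- A labelling of the vertices of H by Fin c whose fibres are exactly the
-- components of H; it exists iff H has at most c components.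
ComponentLabelling : Graph → ℕ → Set
ComponentLabelling H c = Σ (Fin (n H) → Fin c) λ L → ∀ u v →
  (L u ≡ L v → ReachIn H (full H) u v) × (ReachIn H (full H) u v → L u ≡ L v)

_∪_ : {A : Set} → (A → Bool) → (A → Bool) → A → Bool
(S ∪ T) v = S v ∨ T v

edge-same-label : ∀ {H c} ((L , _) : ComponentLabelling H c) → ∀ {x y} → adj H x y ≡ true → L x ≡ L y
edge-same-label (_ , L-components) e = proj₂ (L-components _ _) (step refl e (here refl))

InBranch : (G : Graph) {h : ℕ} → (Fin h → VSet G) → Fin (n G) → Set
InBranch G X v = ∃ λ l → X l v ≡ true

TouchesBranch : (G : Graph) {h : ℕ} → (Fin h → VSet G) → Fin (n G) → Set
TouchesBranch G X v = ∃ λ l → ∃ λ z → X l z ≡ true × adj G v z ≡ true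

IsWitness : (G : Graph) {h : ℕ} → (Fin h → VSet G) → VSet G → VSet G → Fin (n G) → Set
IsWitness G X S T v =
  (∀ l → X l v ≡ false) × (∃[ x ] (S x ≡ true × adj G v x ≡ true)) × (∃[ y ] (T y ≡ true × adj G v y ≡ true))

module Bridges (G H : Graph) {c : ℕ} (X : Fin (n H) → VSet G) (L : Fin (n H) → Fin c) where
  open Walk

  inBranch? : ∀ v → Dec (InBranch G X v)
  inBranch? v = any? (λ l → X l v ≟𝔹 true)

  touchesBranch? : ∀ v → Dec (TouchesBranch G X v)
  touchesBranch? v = any? (λ l → any? (λ z → (X l z ≟𝔹 true) ×-dec (adj G v z ≟𝔹 true)))

  record Bridge : Set where
    field
      a b       : Fin (n H)
      separated : L a ≢ L b
      walk      : Walk G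
      starts    : X a (at walk 0) ≡ true
      ends      : X b (at walk (len walk)) ≡ true

  record Connector : Set where
    field
      a b        : Fin (n H)
      separated  : L a ≢ L b
      P          : VSet G
      P-outside  : ∀ v → P v ≡ true → ∀ l → X l v ≡ false
      joined     : ConnectedSet G (X a ∪ (X b ∪ P))
      p q        : Fin (n G)
      P-touching : ∀ v → P v ≡ true → TouchesBranch G X v → v ≡ p ⊎ v ≡ q

  data Shape (W : Walk G) : Set where
    meets   : ∀ j l → 0 < j → j < len W → X l (at W j) ≡ true → Shape W
    touches : ∀ j l z → 2 ≤ j → j + 2 ≤ len W → X l z ≡ true → adj G (at W j) z ≡ true → Shape W
    clean   : (∀ j → 0 < j → j < len W → ¬ InBranch G X (at W j)) →
              (∀ j → 2 ≤ j → j + 2 ≤ len W → ¬ TouchesBranch G X (at W j)) → Shape W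

  shape : ∀ W → Shape W
  shape W with anyUpTo? (λ j → (0 <? j) ×-dec inBranch? (at W j)) (len W)
  ... | yes (j , j<len , 0<j , l , x) = meets j l 0<j j<len x
  ... | no no-meet
    with anyUpTo? (λ j → (2 ≤? j) ×-dec ((j + 2 ≤? len W) ×-dec touchesBranch? (at W j))) (len W)
  ...   | yes (j , _ , 2≤j , j+2≤len , l , z , x , e) = touches j l z 2≤j j+2≤len x e
  ...   | no no-touch = clean (λ j 0<j j<len m → no-meet (j , j<len , 0<j , m))
      (λ j 2≤j j+2≤len t → no-touch (j , <-≤-trans (m<m+n j (s≤s z≤n)) j+2≤len , 2≤j , j+2≤len , t))

  Shorter : Bridge → Set
  Shorter B = Σ Bridge λ B′ → len (Bridge.walk B′) < len (Bridge.walk B)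

  -- An interior vertex in X l cuts the bridge: keep the part towards the end
  -- whose branch set is labelled differently from l.
  cut-at-branch : (B : Bridge) → let open Bridge B in
    ∀ j l → 0 < j → j < len walk → X l (at walk j) ≡ true → Shorter B
  cut-at-branch B j l 0<j j<len x with L l ≟F L (Bridge.a B)
  ... | yes same = record { a = l ; b = b ; separated = λ e → separated (trans (≡-sym same) e)
                          ; walk = dropW walk j j≤len ; starts = x
                          ; ends = subst (λ i → X b (at walk i) ≡ true) (≡-sym (m∸n+n≡m j≤len)) ends }
                 , ∸-monoʳ-< 0<j j≤len
    where
    open Bridge B
    j≤len : j ≤ len walk
    j≤len = <⇒≤ j<len
  ... | no differ = record { a = a ; b = l ; separated = λ e → differ (≡-sym e)
                           ; walk = takeW walk j (<⇒≤ j<len) ; starts = starts ; ends = x }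
                  , j<len
    where open Bridge B

  -- A vertex far from both ends with a neighbour z in X l also cuts the
  -- bridge, rerouting through z.
  cut-at-touch : (B : Bridge) → let open Bridge B in
    ∀ j l z → 2 ≤ j → j + 2 ≤ len walk → X l z ≡ true → adj G (at walk j) z ≡ true → Shorter B
  cut-at-touch B j l z 2≤j j+2≤len x e with L l ≟F L (Bridge.a B)
  ... | yes same = record { a = l ; b = b ; separated = λ e → separated (trans (≡-sym same) e)
                          ; walk = consW z (dropW walk j j≤len) (trans (Graph.sym G z (at walk j)) e)
                          ; starts = x
                          ; ends = subst (λ i → X b (at walk i) ≡ true) (≡-sym (m∸n+n≡m j≤len)) ends }
                 , subst (2 + (len walk ∸ j) ≤_) (m+[n∸m]≡n j≤len) (+-monoˡ-≤ (len walk ∸ j) 2≤j)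
    where
    open Bridge B
    j≤len : j ≤ len walk
    j≤len = m+n≤o⇒m≤o j j+2≤len
  ... | no differ = record { a = a ; b = l ; separated = λ e → differ (≡-sym e)
                           ; walk = snocW prefix z e ; starts = starts
                           ; ends = subst (λ v → X l v ≡ true) (≡-sym (snocAt-last prefix z)) x }
                  , subst (_≤ len walk) (+-comm j 2) j+2≤len
    where
    open Bridge B
    prefix : Walk G
    prefix = takeW walk j (m+n≤o⇒m≤o j j+2≤len)

  interior : Walk G → VSet G
  interior W v = does (anyUpTo? (λ j → (0 <? j) ×-dec (at W j ≟F v)) (len W))

  interior-sound : ∀ W v → interior W v ≡ true → ∃ λ j → j < len W × 0 < j × at W j ≡ v
  interior-sound W v = dec-sound (anyUpTo? (λ j → (0 <? j) ×-dec (at W j ≟F v)) (len W))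

  interior-complete : ∀ W j → 0 < j → j < len W → interior W (at W j) ≡ true
  interior-complete W j 0<j j<len =
    dec-true (anyUpTo? (λ i → (0 <? i) ×-dec (at W i ≟F at W j)) (len W)) (j , j<len , 0<j , refl)

  -- The end branch sets of a bridge together with its interior are
  -- connected: everything reaches the first vertex of the walk.
  bridge-connected : (∀ i → ConnectedSet G (X i)) → (B : Bridge) → let open Bridge B in
    ConnectedSet G (X a ∪ (X b ∪ interior walk))
  bridge-connected conns B =
    (at walk 0 , on-walk 0 z≤n) , λ u v u∈U v∈U → reach-trans (to-start u u∈U) (reach-sym (to-start v v∈U))
    where
    open Bridge B
    U : VSet G
    U = X a ∪ (X b ∪ interior walk)
    on-walk : ∀ i → i ≤ len walk → U (at walk i) ≡ true
    on-walk zero    _     = ∨-introˡ _ starts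
    on-walk (suc i) i<len with suc i ≟ℕ len walk
    ... | yes refl = ∨-introʳ (X a _) (∨-introˡ _ ends)
    ... | no  ne   = ∨-introʳ (X a _) (∨-introʳ (X b _) (interior-complete walk (suc i) (s≤s z≤n) (≤∧≢⇒< i<len ne)))
    from-start : ∀ i → i ≤ len walk → ReachIn G U (at walk 0) (at walk i)
    from-start zero    _     = here (on-walk 0 z≤n)
    from-start (suc i) i<len = reach-trans (from-start i (<⇒≤ i<len))
      (step (on-walk i (<⇒≤ i<len)) (edge walk i i<len) (here (on-walk (suc i) i<len)))
    to-start : ∀ v → U v ≡ true → ReachIn G U v (at walk 0)
    to-start v v∈U with ∨-split {X a v} v∈U
    ... | inj₁ v∈Xa = reach-mono (λ x x∈Xa → ∨-introˡ _ x∈Xa) (proj₂ (conns a) v (at walk 0) v∈Xa starts)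
    ... | inj₂ v∈rest with ∨-split {X b v} v∈rest
    ...   | inj₁ v∈Xb = reach-trans
              (reach-mono (λ x x∈Xb → ∨-introʳ (X a x) (∨-introˡ _ x∈Xb)) (proj₂ (conns b) v _ v∈Xb ends))
              (reach-sym (from-start (len walk) ≤-refl))
    ...   | inj₂ v∈P with interior-sound walk v v∈P
    ...     | j , j<len , _ , refl = reach-sym (from-start j (<⇒≤ j<len))

  -- A bridge without obstructions is a connector with p, q the second and
  -- the penultimate vertex.
  clean-connector : (∀ i → ConnectedSet G (X i)) → (B : Bridge) → let open Bridge B in
    (∀ j → 0 < j → j < len walk → ¬ InBranch G X (at walk j)) →
    (∀ j → 2 ≤ j → j + 2 ≤ len walk → ¬ TouchesBranch G X (at walk j)) → Connector
  clean-connector conns B no-meet no-touch = record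
    { a = a ; b = b ; separated = separated ; P = interior walk ; P-outside = outside
    ; joined = bridge-connected conns B ; p = at walk 1 ; q = at walk (len walk ∸ 1) ; P-touching = touching }
    where
    open Bridge B
    outside : ∀ v → interior walk v ≡ true → ∀ l → X l v ≡ false
    outside v v∈P l with interior-sound walk v v∈P
    ... | j , j<len , 0<j , refl = ¬-not (λ x → no-meet j 0<j j<len (l , x))
    touching : ∀ v → interior walk v ≡ true → TouchesBranch G X v → v ≡ at walk 1 ⊎ v ≡ at walk (len walk ∸ 1)
    touching v v∈P t with interior-sound walk v v∈P
    ... | j , j<len , 0<j , refl with 2 ≤? j | j + 2 ≤? len walk
    ...   | yes 2≤j | yes j+2≤len = ⊥-elim (no-touch j 2≤j j+2≤len t)
    ...   | no  j≱2 | _           = inj₁ (cong (at walk) (≤-antisym (s≤s⁻¹ (≰⇒> j≱2)) 0<j))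
    ...   | yes _   | no  j+2≰len = inj₂ (cong (at walk) (≡-sym (cong (_∸ 1) len≡1+j)))
      where
      len≡1+j : len walk ≡ suc j
      len≡1+j = ≤-antisym (s≤s⁻¹ (subst (len walk <_) (+-comm j 2) (≰⇒> j+2≰len))) j<len

  connector : (∀ i → ConnectedSet G (X i)) → Bridge → Connector
  connector conns B₀ = <-rec (λ m → ∀ B → len (Bridge.walk B) ≡ m → Connector) shorten _ B₀ refl
    where
    shorten : ∀ m → (∀ {m′} → m′ < m → ∀ B → len (Bridge.walk B) ≡ m′ → Connector) →
              ∀ B → len (Bridge.walk B) ≡ m → Connector
    shorten _ rec B refl with shape (Bridge.walk B)
    ... | meets j l 0<j j<len x =
          let (B′ , shorter) = cut-at-branch B j l 0<j j<len x in rec shorter B′ refl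
    ... | touches j l z 2≤j j+2≤len x e =
          let (B′ , shorter) = cut-at-touch B j l z 2≤j j+2≤len x e in rec shorter B′ refl
    ... | clean no-meet no-touch = clean-connector conns B no-meet no-touch

-- Identification of two distinct non-adjacent vertices a, b of a graph H
-- on Fin (suc m): b is deleted and its edges are moved to a.
module Identify {m : ℕ} (A : Fin (suc m) → Fin (suc m) → Bool)
  (A-sym : ∀ u v → A u v ≡ A v u) (A-irrefl : ∀ v → A v v ≡ false)
  (a b : Fin (suc m)) (b≢a : b ≢ a) (a≁b : A a b ≡ false) where

  H : Graph
  H = record { n = suc m ; adj = A ; sym = A-sym ; irrefl = A-irrefl }

  s : Fin m → Fin (suc m)
  s = punchIn b

  a′ : Fin m
  a′ = punchOut b≢a

  s-a′ : s a′ ≡ a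
  s-a′ = punchIn-punchOut b≢a

  is-a′ : Fin m → Bool
  is-a′ y = does (y ≟F a′)

  is-a′-a′ : is-a′ a′ ≡ true
  is-a′-a′ = dec-true (a′ ≟F a′) refl

  is-a′-sound : ∀ {y} → is-a′ y ≡ true → s y ≡ a
  is-a′-sound {y} e = trans (cong s (dec-sound (y ≟F a′) e)) s-a′

  b≁a : A b a ≡ false
  b≁a = trans (A-sym b a) a≁b

  A′ : Fin m → Fin m → Bool
  A′ y z = A (s y) (s z) ∨ ((is-a′ y ∧ A b (s z)) ∨ (is-a′ z ∧ A (s y) b))

  A′-sym : ∀ y z → A′ y z ≡ A′ z y
  A′-sym y z = cong₂ _∨_ (A-sym (s y) (s z))
    (trans (cong₂ _∨_ (cong (is-a′ y ∧_) (A-sym b (s z))) (cong (is-a′ z ∧_) (A-sym (s y) b)))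
           (∨-comm (is-a′ y ∧ A (s z) b) (is-a′ z ∧ A b (s y))))

  A′-irrefl : ∀ y → A′ y y ≡ false
  A′-irrefl y with y ≟F a′
  ... | yes refl rewrite A-irrefl (s a′) | s-a′ | b≁a | a≁b = refl
  ... | no  _    rewrite A-irrefl (s y) = refl

  H′ : Graph
  H′ = record { n = m ; adj = A′ ; sym = A′-sym ; irrefl = A′-irrefl }

  -- If a and b have no common neighbour, no two edges of H are merged, so
  -- H′ has as many edges as H.  We compare degree sums.
  module _ (no-common : ∀ x → A a x ≡ true → A b x ≡ false) where

    edges-within : ℕ
    edges-within = ∑[ y < m ] ∑[ z < m ] ind (A (s y) (s z))

    row-b column-b : ℕ
    row-b    = ∑[ z < m ] ind (A b (s z))
    column-b = ∑[ y < m ] ind (A (s y) b)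

    degreeSum-H : degreeSum H ≡ row-b + (column-b + edges-within)
    degreeSum-H = begin
      degreeSum H
        ≡⟨ sum-remove {i = b} (λ x → ∑[ x′ < suc m ] ind (A x x′)) ⟩
      ∑[ x < suc m ] ind (A b x) + ∑[ y < m ] ∑[ x < suc m ] ind (A (s y) x)
        ≡⟨ cong₂ _+_ (sum-remove {i = b} (λ x → ind (A b x)))
                     (sum-cong-≗ (λ y → sum-remove {i = b} (λ x → ind (A (s y) x)))) ⟩
      (ind (A b b) + row-b) + ∑[ y < m ] (ind (A (s y) b) + ∑[ z < m ] ind (A (s y) (s z)))
        ≡⟨ cong₂ _+_ (cong (λ t → ind t + row-b) (A-irrefl b))
                     (∑-distrib-+ (λ y → ind (A (s y) b)) (λ y → ∑[ z < m ] ind (A (s y) (s z)))) ⟩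
      row-b + (column-b + edges-within)
        ∎
      where open ≡-Reasoning

    degreeSum-H′ : degreeSum H′ ≡ edges-within + (row-b + column-b)
    degreeSum-H′ = begin
      degreeSum H′
        ≡⟨ sum-cong-≗ (λ y → sum-cong-≗ (λ z →
             ind-∨₃ _ _ _ (within-row y z) (within-column y z) (row-column y z))) ⟩
      ∑[ y < m ] ∑[ z < m ] (within y z + (row y z + column y z))
        ≡⟨ sum-cong-≗ (λ y → trans (∑-distrib-+ (within y) (λ z → row y z + column y z))
                                   (cong (∑[ z < m ] within y z +_) (∑-distrib-+ (row y) (column y)))) ⟩
      ∑[ y < m ] (∑[ z < m ] within y z + (∑[ z < m ] row y z + ∑[ z < m ] column y z))
        ≡⟨ trans (∑-distrib-+ (λ y → ∑[ z < m ] within y z) _)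
                 (cong (edges-within +_) (∑-distrib-+ (λ y → ∑[ z < m ] row y z) (λ y → ∑[ z < m ] column y z))) ⟩
      edges-within + (∑[ y < m ] ∑[ z < m ] row y z + ∑[ y < m ] ∑[ z < m ] column y z)
        ≡⟨ cong (edges-within +_) (cong₂ _+_ moved-row moved-column) ⟩
      edges-within + (row-b + column-b)
        ∎
      where
      open ≡-Reasoning
      within row column : Fin m → Fin m → ℕ
      within y z = ind (A (s y) (s z))
      row    y z = ind (is-a′ y ∧ A b (s z))
      column y z = ind (is-a′ z ∧ A (s y) b)
      within-row : ∀ y z → A (s y) (s z) ≡ true → is-a′ y ∧ A b (s z) ≡ true → ⊥
      within-row y z e e′ = true≢false (∧-proj₂ e′)
        (no-common (s z) (subst (λ x → A x (s z) ≡ true) (is-a′-sound (∧-proj₁ e′)) e))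
      within-column : ∀ y z → A (s y) (s z) ≡ true → is-a′ z ∧ A (s y) b ≡ true → ⊥
      within-column y z e e′ = true≢false (trans (A-sym b (s y)) (∧-proj₂ e′))
        (no-common (s y) (trans (A-sym a (s y)) (subst (λ x → A (s y) x ≡ true) (is-a′-sound (∧-proj₁ e′)) e)))
      row-column : ∀ y z → is-a′ y ∧ A b (s z) ≡ true → is-a′ z ∧ A (s y) b ≡ true → ⊥
      row-column y z e e′ = true≢false (subst (λ x → A b x ≡ true) (is-a′-sound (∧-proj₁ e′)) (∧-proj₂ e)) b≁a
      moved-row : ∑[ y < m ] ∑[ z < m ] row y z ≡ row-b
      moved-row = trans (∑-comm row)
        (sum-cong-≗ (λ z → trans (sum-cong-≗ (λ y → ind-∧ (is-a′ y) (A b (s z)))) (sum-point a′ (ind (A b (s z))))))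
      moved-column : ∑[ y < m ] ∑[ z < m ] column y z ≡ column-b
      moved-column = sum-cong-≗ (λ y →
        trans (sum-cong-≗ (λ z → ind-∧ (is-a′ z) (A (s y) b))) (sum-point a′ (ind (A (s y) b))))

    numEdges-preserved : numEdges H′ ≡ numEdges H
    numEdges-preserved = *-cancelˡ-≡ _ _ 2 (begin
      2 * numEdges H′                     ≡⟨ ≡-sym (handshake H′) ⟩
      degreeSum H′                        ≡⟨ degreeSum-H′ ⟩
      edges-within + (row-b + column-b)   ≡⟨ +-comm edges-within _ ⟩
      (row-b + column-b) + edges-within   ≡⟨ +-assoc row-b column-b edges-within ⟩
      row-b + (column-b + edges-within)   ≡⟨ ≡-sym degreeSum-H ⟩
      degreeSum H                         ≡⟨ handshake H ⟩
      2 * numEdges H                      ∎)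
      where open ≡-Reasoning

  collapse : Fin (suc m) → Fin m
  collapse x with x ≟F b
  ... | yes _   = a′
  ... | no  x≢b = punchOut (≢-sym x≢b)

  collapse-b : collapse b ≡ a′
  collapse-b with b ≟F b
  ... | yes _   = refl
  ... | no  b≢b = ⊥-elim (b≢b refl)

  s-collapse : ∀ x → x ≢ b → s (collapse x) ≡ x
  s-collapse x x≢b with x ≟F b
  ... | yes x≡b = ⊥-elim (x≢b x≡b)
  ... | no  _   = punchIn-punchOut _

  collapse-s : ∀ y → collapse (s y) ≡ y
  collapse-s y with s y ≟F b
  ... | yes sy≡b = ⊥-elim (punchInᵢ≢i b y sy≡b)
  ... | no  _    = trans (punchOut-cong b refl) (punchOut-punchIn b)

  collapse-a≡collapse-b : collapse a ≡ collapse b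
  collapse-a≡collapse-b = trans (cong collapse (≡-sym s-a′)) (trans (collapse-s a′) (≡-sym collapse-b))

  collapse-edge : ∀ {x x′} → A x x′ ≡ true → A′ (collapse x) (collapse x′) ≡ true
  collapse-edge {x} {x′} e with b ≟F x | b ≟F x′
  ... | yes refl | yes refl = ⊥-elim (true≢false e (A-irrefl b))
  ... | yes refl | no  b≢x′ rewrite collapse-b =
        ∨-introʳ (A (s a′) (s (collapse x′))) (∨-introˡ _
          (∧-intro is-a′-a′ (subst (λ t → A b t ≡ true) (≡-sym (s-collapse x′ (≢-sym b≢x′))) e)))
  ... | no  b≢x  | yes refl rewrite collapse-b =
        ∨-introʳ (A (s (collapse x)) (s a′)) (∨-introʳ (is-a′ (collapse x) ∧ A b (s a′))
          (∧-intro is-a′-a′ (subst (λ t → A t b ≡ true) (≡-sym (s-collapse x (≢-sym b≢x))) e)))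
  ... | no  b≢x  | no  b≢x′ =
        ∨-introˡ _ (subst₂ (λ u v → A u v ≡ true)
          (≡-sym (s-collapse x (≢-sym b≢x))) (≡-sym (s-collapse x′ (≢-sym b≢x′))) e)

  collapse-reach : ∀ {x x′} → ReachIn H (full H) x x′ → ReachIn H′ (full H′) (collapse x) (collapse x′)
  collapse-reach (here _)     = here refl
  collapse-reach (step _ e r) = step refl (collapse-edge e) (collapse-reach r)

  merged-labelling : ∀ {c} (lab : ComponentLabelling H (suc (suc c))) →
    proj₁ lab a ≢ proj₁ lab b → ComponentLabelling H′ (suc c)
  merged-labelling {c} (L , L-components) La≢Lb = L′ , λ y z → same-label⇒reach y z , reach⇒same-label
    where
    Lb≢La : L b ≢ L a
    Lb≢La e = La≢Lb (≡-sym e)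

    merge : Fin (suc (suc c)) → Fin (suc c)
    merge ℓ with L b ≟F ℓ
    ... | yes _    = punchOut Lb≢La
    ... | no  Lb≢ℓ = punchOut Lb≢ℓ

    merge-a≡merge-b : merge (L a) ≡ merge (L b)
    merge-a≡merge-b with L b ≟F L a | L b ≟F L b
    ... | yes Lb≡La | _        = ⊥-elim (Lb≢La Lb≡La)
    ... | no  _     | yes _    = punchOut-cong (L b) refl
    ... | no  _     | no  Lb≢Lb = ⊥-elim (Lb≢Lb refl)

    merge-inv : ∀ ℓ ℓ′ → merge ℓ ≡ merge ℓ′ →
      ℓ ≡ ℓ′ ⊎ ((ℓ ≡ L a × ℓ′ ≡ L b) ⊎ (ℓ ≡ L b × ℓ′ ≡ L a))
    merge-inv ℓ ℓ′ e with L b ≟F ℓ | L b ≟F ℓ′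
    ... | yes Lb≡ℓ | yes Lb≡ℓ′ = inj₁ (trans (≡-sym Lb≡ℓ) Lb≡ℓ′)
    ... | yes Lb≡ℓ | no  Lb≢ℓ′ = inj₂ (inj₂ (≡-sym Lb≡ℓ , ≡-sym (punchOut-injective Lb≢La Lb≢ℓ′ e)))
    ... | no  Lb≢ℓ | yes Lb≡ℓ′ = inj₂ (inj₁ (punchOut-injective Lb≢ℓ Lb≢La e , ≡-sym Lb≡ℓ′))
    ... | no  Lb≢ℓ | no  Lb≢ℓ′ = inj₁ (punchOut-injective Lb≢ℓ Lb≢ℓ′ e)

    L′ : Fin m → Fin (suc c)
    L′ y = merge (L (s y))

    edge-label : ∀ {x x′} → A x x′ ≡ true → L x ≡ L x′
    edge-label = edge-same-label (L , L-components)

    edge-label′ : ∀ {y z} → A′ y z ≡ true → L′ y ≡ L′ z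
    edge-label′ {y} {z} e with ∨-split {A (s y) (s z)} e
    ... | inj₁ within = cong merge (edge-label within)
    ... | inj₂ moved with ∨-split {is-a′ y ∧ A b (s z)} moved
    ...   | inj₁ row = trans (cong (λ x → merge (L x)) (is-a′-sound (∧-proj₁ row)))
                         (trans merge-a≡merge-b (cong merge (edge-label (∧-proj₂ row))))
    ...   | inj₂ column = trans (cong merge (edge-label (∧-proj₂ column)))
                         (trans (≡-sym merge-a≡merge-b) (cong (λ x → merge (L x)) (≡-sym (is-a′-sound (∧-proj₁ column)))))

    reach⇒same-label : ∀ {y z} → ReachIn H′ (full H′) y z → L′ y ≡ L′ z
    reach⇒same-label (here _)     = refl
    reach⇒same-label (step _ e r) = trans (edge-label′ e) (reach⇒same-label r)

    image : ∀ {x x′} → L x ≡ L x′ → ReachIn H′ (full H′) (collapse x) (collapse x′)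
    image {x} {x′} e = collapse-reach (proj₁ (L-components x x′) e)

    uncollapse : ∀ {y z} → ReachIn H′ (full H′) (collapse (s y)) (collapse (s z)) → ReachIn H′ (full H′) y z
    uncollapse {y} {z} = subst₂ (ReachIn H′ (full H′)) (collapse-s y) (collapse-s z)

    same-label⇒reach : ∀ y z → L′ y ≡ L′ z → ReachIn H′ (full H′) y z
    same-label⇒reach y z e with merge-inv (L (s y)) (L (s z)) e
    ... | inj₁ same = uncollapse (image same)
    ... | inj₂ (inj₁ (y∼a , z∼b)) = uncollapse (reach-trans (image y∼a)
          (subst (λ t → ReachIn H′ (full H′) t (collapse (s z))) (≡-sym collapse-a≡collapse-b) (image (≡-sym z∼b))))
    ... | inj₂ (inj₂ (y∼b , z∼a)) = uncollapse (reach-trans (image y∼b)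
          (subst (λ t → ReachIn H′ (full H′) t (collapse (s z))) collapse-a≡collapse-b (image (≡-sym z∼a))))

  -- Given an (M + 2)-strong model of H and a connector P from X a to X b
  -- (P avoids the branch sets, X a ∪ X b ∪ P is connected, and only p, q
  -- of P touch branch sets), the branch set X a ∪ X b ∪ P for a′ and X (s y)
  -- for the other y form an M-strong model of H′: each witness family only
  -- has to give up p and q.
  module MergedModel {G : Graph} {M : ℕ} (model : StrongModel (suc (suc M)) H G) (P : VSet G)
    (P-outside : ∀ v → P v ≡ true → ∀ l → proj₁ model l v ≡ false)
    (joined : ConnectedSet G (proj₁ model a ∪ (proj₁ model b ∪ P)))
    (p q : Fin (n G))
    (P-touching : ∀ v → P v ≡ true → TouchesBranch G (proj₁ model) v → v ≡ p ⊎ v ≡ q) where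

    X : Fin (suc m) → VSet G
    X = proj₁ model

    X-disjoint : ∀ i j x → i ≢ j → X i x ≡ true → X j x ≡ false
    X-disjoint = proj₁ (proj₂ (proj₂ model))

    U : VSet G
    U = X a ∪ (X b ∪ P)

    U-false : ∀ {v} → X a v ≡ false → X b v ≡ false → P v ≡ false → U v ≡ false
    U-false e₁ e₂ e₃ = cong₂ _∨_ e₁ (cong₂ _∨_ e₂ e₃)

    X′ : Fin m → VSet G
    X′ y with y ≟F a′
    ... | yes _ = U
    ... | no  _ = X (s y)

    X′-connected : ∀ y → ConnectedSet G (X′ y)
    X′-connected y with y ≟F a′
    ... | yes _ = joined
    ... | no  _ = proj₁ (proj₂ model) (s y)

    X⊆X′ : ∀ y v → X (s y) v ≡ true → X′ y v ≡ true
    X⊆X′ y v v∈X with y ≟F a′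
    ... | yes refl = ∨-introˡ _ (subst (λ t → X t v ≡ true) s-a′ v∈X)
    ... | no  _    = v∈X

    Xb⊆X′a′ : ∀ y → y ≡ a′ → ∀ v → X b v ≡ true → X′ y v ≡ true
    Xb⊆X′a′ y y≡a′ v v∈Xb with y ≟F a′
    ... | yes _   = ∨-introʳ (X a v) (∨-introˡ _ v∈Xb)
    ... | no  y≢a′ = ⊥-elim (y≢a′ y≡a′)

    s≢a : ∀ y → y ≢ a′ → s y ≢ a
    s≢a y y≢a′ e = y≢a′ (punchIn-injective b y a′ (trans e (≡-sym s-a′)))

    X′-disjoint : ∀ y z v → y ≢ z → X′ y v ≡ true → X′ z v ≡ false
    X′-disjoint y z v y≢z v∈y with y ≟F a′ | z ≟F a′
    ... | yes refl | yes refl = ⊥-elim (y≢z refl)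
    ... | yes refl | no  z≢a′ with ∨-split {X a v} v∈y
    ...   | inj₁ v∈Xa = X-disjoint a (s z) v (λ e → s≢a z z≢a′ (≡-sym e)) v∈Xa
    ...   | inj₂ v∈rest with ∨-split {X b v} v∈rest
    ...     | inj₁ v∈Xb = X-disjoint b (s z) v (λ e → punchInᵢ≢i b z (≡-sym e)) v∈Xb
    ...     | inj₂ v∈P  = P-outside v v∈P (s z)
    X′-disjoint y z v y≢z v∈y | no y≢a′ | yes refl =
      U-false (X-disjoint (s y) a v (s≢a y y≢a′) v∈y) (X-disjoint (s y) b v (punchInᵢ≢i b y) v∈y)
              (¬-not (λ v∈P → true≢false v∈y (P-outside v v∈P (s y))))
    X′-disjoint y z v y≢z v∈y | no _ | no _ = X-disjoint (s y) (s z) v (λ e → y≢z (punchIn-injective b y z e)) v∈y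

    witness-outside : ∀ v → (∀ l → X l v ≡ false) → v ≢ p → v ≢ q → TouchesBranch G X v → ∀ y → X′ y v ≡ false
    witness-outside v outside v≢p v≢q touching y with y ≟F a′
    ... | yes _ = U-false (outside a) (outside b) (¬-not (λ v∈P → [ v≢p , v≢q ]′ (P-touching v v∈P touching)))
    ... | no  _ = outside (s y)

    lift-edge : ∀ y z → A′ y z ≡ true → Σ (Fin (suc m)) λ i → Σ (Fin (suc m)) λ j → A i j ≡ true ×
      (∀ v → X i v ≡ true → X′ y v ≡ true) × (∀ v → X j v ≡ true → X′ z v ≡ true)
    lift-edge y z e with ∨-split {A (s y) (s z)} e
    ... | inj₁ within = s y , s z , within , X⊆X′ y , X⊆X′ z
    ... | inj₂ moved with ∨-split {is-a′ y ∧ A b (s z)} moved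
    ...   | inj₁ row    = b , s z , ∧-proj₂ row , Xb⊆X′a′ y (dec-sound (y ≟F a′) (∧-proj₁ row)) , X⊆X′ z
    ...   | inj₂ column = s y , b , ∧-proj₂ column , X⊆X′ y , Xb⊆X′a′ z (dec-sound (z ≟F a′) (∧-proj₁ column))

    witnesses′ : ∀ y z → A′ y z ≡ true →
      Σ (Fin M → Fin (n G)) λ g → Injective _≡_ _≡_ g × (∀ t → IsWitness G X′ (X′ y) (X′ z) (g t))
    witnesses′ y z e with lift-edge y z e
    ... | i , j , ij , i⊆y , j⊆z with proj₂ (proj₂ (proj₂ model)) i j ij
    ...   | f , f-inj , f-ok with avoid-value _≟F_ f f-inj p
    ...     | h₁ , fh₁-inj , ≢p with avoid-value _≟F_ (λ t → f (h₁ t)) fh₁-inj q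
    ...       | h₂ , fh₁h₂-inj , ≢q = (λ t → f (h₁ (h₂ t))) , fh₁h₂-inj , still-witness
      where
      still-witness : ∀ t → IsWitness G X′ (X′ y) (X′ z) (f (h₁ (h₂ t)))
      still-witness t with f-ok (h₁ (h₂ t))
      ... | outside , (x , x∈i , ex) , (x′ , x′∈j , ex′) =
            witness-outside _ outside (≢p (h₂ t)) (≢q t) (i , x , x∈i , ex)
            , (x , i⊆y x x∈i , ex) , (x′ , j⊆z x′ x′∈j , ex′)

    model′ : StrongModel M H′ G
    model′ = X′ , X′-connected , X′-disjoint , witnesses′

merge-step : ∀ {G : Graph} {c M} (H : Graph) → Connected G →
  (lab : ComponentLabelling H (suc (suc c))) → StrongModel (suc (suc M)) H G →
  ∀ u v → proj₁ lab u ≢ proj₁ lab v →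
  Σ Graph λ H′ → ComponentLabelling H′ (suc c) × numEdges H′ ≡ numEdges H × StrongModel M H′ G
merge-step record { n = zero } _ _ _ () _ _
merge-step {G} {c} H@record { n = suc m ; adj = A ; sym = A-sym ; irrefl = A-irrefl } G-conn lab model u v Lu≢Lv =
  H′ , merged-labelling lab separated , numEdges-preserved no-common , model′
  where
  L : Fin (suc m) → Fin (suc (suc c))
  L = proj₁ lab
  X : Fin (suc m) → VSet G
  X = proj₁ model
  X-connected : ∀ i → ConnectedSet G (X i)
  X-connected = proj₁ (proj₂ model)
  open Bridges G H X L using (Bridge; connector)

  initial : Bridge
  initial with toWalk (proj₂ G-conn _ _ refl refl)
  ... | W , start , end = record
    { a = u ; b = v ; separated = Lu≢Lv ; walk = W
    ; starts = subst (λ t → X u t ≡ true) (≡-sym start) (proj₂ (proj₁ (X-connected u)))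
    ; ends   = subst (λ t → X v t ≡ true) (≡-sym end)   (proj₂ (proj₁ (X-connected v))) }

  open Bridges.Connector (connector X-connected initial)

  b≢a : b ≢ a
  b≢a b≡a = separated (cong L (≡-sym b≡a))

  a≁b : A a b ≡ false
  a≁b = ¬-not (λ e → separated (edge-same-label lab e))

  no-common : ∀ x → A a x ≡ true → A b x ≡ false
  no-common x ax = ¬-not (λ bx → separated (trans (edge-same-label lab ax) (≡-sym (edge-same-label lab bx))))

  open Identify A A-sym A-irrefl a b b≢a a≁b
  open MergedModel model P P-outside joined p q P-touching

strength-suc : ∀ k c → k + 2 * suc c ≡ (k + 2 * c) + 2
strength-suc = solve-∀

budget-≤ : ∀ k c M → k + 2 * suc c ≤ M + 2 → k ≤ M
budget-≤ k c M le =
  ≤-trans (m≤m+n k (2 * c)) (+-cancelʳ-≤ 2 (k + 2 * c) M (subst (_≤ M + 2) (strength-suc k c) le))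

budget-step : ∀ k c M → k + 2 * suc (suc c) ≤ M + 2 → Σ ℕ λ M′ → M ≡ suc (suc M′) × k + 2 * suc c ≤ M′ + 2
budget-step k c M le = M ∸ 2 , ≡-sym (m+[n∸m]≡n 2≤M) , subst (k + 2 * suc c ≤_) (≡-sym (m∸n+n≡m 2≤M)) rest≤M
  where
  rest≤M : k + 2 * suc c ≤ M
  rest≤M = +-cancelʳ-≤ 2 (k + 2 * suc c) M (subst (_≤ M + 2) (strength-suc k (suc c)) le)
  2≤M : 2 ≤ M
  2≤M = ≤-trans (≤-trans (*-monoʳ-≤ 2 (s≤s (z≤n {c}))) (m≤n+m (2 * suc c) k)) rest≤M

uniform-or-split : ∀ {A : Set} {h} → (∀ (x y : A) → Dec (x ≡ y)) → (L : Fin h → A) →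
  (∀ u v → L u ≡ L v) ⊎ (∃ λ u → ∃ λ v → L u ≢ L v)
uniform-or-split _≟A_ L with all? (λ u → all? (λ v → L u ≟A L v))
... | yes uniform = inj₁ uniform
... | no  ¬uniform with ¬∀⟶∃¬ _ _ (λ u → all? (λ v → L u ≟A L v)) ¬uniform
...   | u , ¬all-u with ¬∀⟶∃¬ _ _ (λ v → L u ≟A L v) ¬all-u
...     | v , Lu≢Lv = inj₂ (u , v , Lu≢Lv)

module _ (k : ℕ) (G : Graph) (G-conn : Connected G) where

  reduce : ∀ c (H : Graph) M → k + 2 * c ≤ M + 2 → ComponentLabelling H c → StrongModel M H G → Conclusion k G H
  reduce zero H M _ (L , _) model =
    connected-case G H G-conn (λ u → ⊥-elim (¬Fin0 (L u))) (λ u → ⊥-elim (¬Fin0 (L u))) model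
  reduce (suc zero) H M le (L , L-components) model =
    connected-case G H G-conn (λ u v → proj₁ (L-components u v) (one-label (L u) (L v))) (λ _ → budget-≤ k 0 M le) model
    where
    one-label : ∀ (i j : Fin 1) → i ≡ j
    one-label zero zero = refl
  reduce (suc (suc c)) H M le lab@(L , L-components) model with uniform-or-split _≟F_ L
  ... | inj₁ uniform =
        connected-case G H G-conn (λ u v → proj₁ (L-components u v) (uniform u v)) (λ _ → budget-≤ k (suc c) M le) model
  ... | inj₂ (u , v , Lu≢Lv) with budget-step k c M le
  ...   | M′ , refl , le′ with merge-step H G-conn lab model u v Lu≢Lv
  ...     | H′ , lab′ , same-edges , model′ with reduce (suc c) H′ M′ le′ lab′ model′
  ...       | H″ , H″-conn , edges , model″ = H″ , H″-conn , trans edges same-edges , model″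

lemma16 : (k : ℕ) → 2 ≤ k → (G H : Graph) (c : ℕ) →
    Connected G → HasComponents H c →
    StrongModel (k + 2 * c ∸ 2) H G →
    Σ Graph (λ H' → Connected H' × numEdges H' ≡ numEdges H × StrongModel k H' G)
lemma16 k _ G H c G-conn (L , _ , L-components) model =
  reduce k G G-conn c H (k + 2 * c ∸ 2) budget (L , L-components) model
  where
  budget : k + 2 * c ≤ (k + 2 * c ∸ 2) + 2
  budget = subst (k + 2 * c ≤_) (+-comm 2 _) (m≤n+m∸n (k + 2 * c) 2)
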